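{- Let $\mathcal{MC}$ be the family of all $\exists$-saturated maximal $\mathsf{FOL\Box}$-consistent sets. For all $\Gamma,\Delta\in\mathcal{MC}$, every $\Box$-free formula $A$, and every elementary disjunction $D$: (i) $\Box A\in\Gamma \iff \Box A\in\Delta$; (ii) $\Diamond A\in\Gamma\iff\Diamond A\in\Delta$; (iii) $\Box D\in\Gamma\iff\Box D\in\Delta$.
   Context: Language $\mathcal{L}(\forall,\Box)$: first-order language with identity $=$, predicate symbols, variables, no constants or function symbols, connectives $\neg,\to$, quantifier $\forall$, modal operator $\Box$ (arbitrary nesting); $\Diamond:=\neg\Box\neg$. A formula is $\Box$-free if it contains no $\Box$. $\mathsf{FOL}$ is the set of $\Box$-free theses of classical first-order logic with identity. An occurrence of $x$ in $A$ is $\forall\Box$-bound if it is in the scope of a quantifier on $x$ or inside the scope of some $\Box$; otherwise $\forall\Box$-free. $x$ is a $\forall\Box$-free variable of $A$ if it has a $\forall\Box$-free occurrence. $A(^y/_x)$ is the simultaneous replacement of every $\forall\Box$-free occurrence of $x$ by $y$, provided $y$ is not captured by a quantifier. $\mathsf{FOL\Box}$ is the smallest set of formulas containing all instances of propositional tautologies and all instances of: $\Box(A\to B)\to(\Box A\to\Box B)$; $\Box A\to A$; $\neg\Box A\to\Box\neg\Box A$; $\forall xA\to A(^y/_x)$ (admissible $\forall\Box$-free substitution); $\forall x(A\to B)\to(A\to\forall xB)$ if $x$ is not $\forall\Box$-free in $A$; $x=x$; $x=y\wedge A(x)\to A(y)$ for $\Box$-free $A$ (usual first-order identity axiom); $\Box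 A\to\forall xA$; $\neg\Box A$ for every $\Box$-free $A\notin\mathsf{FOL}$; closed under: $A\in\mathsf{FOL\Box}\Rightarrow\Box A\in\mathsf{FOL\Box}$, and modus ponens. A set $\Gamma$ is $\mathsf{FOL\Box}$-consistent if there is no finite $\{B_1,\dots,B_k\}\subseteq\Gamma$ with $\neg(B_1\wedge\dots\wedge B_k)\in\mathsf{FOL\Box}$; maximal consistent if consistent and no proper superset is consistent. $\Gamma$ is $\exists$-saturated if for every $\neg\forall xA\in\Gamma$ there is a variable $y$ with $A(^y/_x)$ admissible and $\neg A(^y/_x)\in\Gamma$. An elementary disjunction is a formula $A\vee\Diamond B\vee\Box C_1\vee\dots\vee\Box C_n$ where $A,B,C_1,\dots,C_n$ are $\Box$-free formulas. -}

module Defs where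

open import Data.Nat using (ℕ; _≟_)
open import Data.Bool using (Bool; true; false; not; _∨_; if_then_else_)
open import Data.Vec using (Vec; map)
open import Data.Vec.Membership.Propositional using (_∈_)
open import Data.Vec.Relation.Binary.Pointwise.Inductive using (Pointwise)
open import Data.List using (List; []; _∷_) renaming (map to lmap)
open import Data.List.Relation.Unary.All using (All)
open import Data.Product using (_×_; Σ; ∃; ∃-syntax)
open import Data.Sum using (_⊎_)
open import Relation.Nullary using (¬_; Dec; yes; no)
open import Relation.Binary.PropositionalEquality using (_≡_; _≢_)

record Signature : Set₁ where
  field
    PredSym : Set
    arity   : PredSym → ℕ

module Logic (S : Signature) where
  open Signature S

  Var : Set
  Var = ℕ

  data Fm : Set where
    atom : (p : PredSym) → Vec Var (arity p) → Fm
    _≐_  : Var → Var → Fm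
    ¬'_  : Fm → Fm
    _⇒_  : Fm → Fm → Fm
    ∀'   : Var → Fm → Fm
    □_   : Fm → Fm

  infixr 5 _⇒_
  infix 9 _≐_
  infix 7 ¬'_ □_

  _∧'_ : Fm → Fm → Fm
  A ∧' B = ¬' (A ⇒ ¬' B)
  infixr 6 _∧'_ _∨'_
  infix 7 ◇_

  _∨'_ : Fm → Fm → Fm
  A ∨' B = (¬' A) ⇒ B

  ◇_ : Fm → Fm
  ◇ A = ¬' (□ (¬' A))

  data BoxFree : Fm → Set where
    bf-atom : ∀ {p xs} → BoxFree (atom p xs)
    bf-eq   : ∀ {x y} → BoxFree (x ≐ y)
    bf-neg  : ∀ {A} → BoxFree A → BoxFree (¬' A)
    bf-imp  : ∀ {A B} → BoxFree A → BoxFree B → BoxFree (A ⇒ B)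
    bf-all  : ∀ {x A} → BoxFree A → BoxFree (∀' x A)

  data FreeIn (x : Var) : Fm → Set where
    fr-atom : ∀ {p xs} → x ∈ xs → FreeIn x (atom p xs)
    fr-eqˡ  : ∀ {y z} → x ≡ y → FreeIn x (y ≐ z)
    fr-eqʳ  : ∀ {y z} → x ≡ z → FreeIn x (y ≐ z)
    fr-neg  : ∀ {A} → FreeIn x A → FreeIn x (¬' A)
    fr-impˡ : ∀ {A B} → FreeIn x A → FreeIn x (A ⇒ B)
    fr-impʳ : ∀ {A B} → FreeIn x B → FreeIn x (A ⇒ B)
    fr-all  : ∀ {z A} → z ≢ x → FreeIn x A → FreeIn x (∀' z A)

  rn : Var → Var → Var → Var
  rn y x z with z ≟ x
  ... | yes _ = y
  ... | no  _ = z

  -- sub y x A = A(y/x): replace every ∀□-free occurrence of x by y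
  sub : Var → Var → Fm → Fm
  sub y x (atom p xs) = atom p (map (rn y x) xs)
  sub y x (u ≐ v)     = rn y x u ≐ rn y x v
  sub y x (¬' A)      = ¬' sub y x A
  sub y x (A ⇒ B)     = sub y x A ⇒ sub y x B
  sub y x (∀' z A) with z ≟ x
  ... | yes _ = ∀' z A
  ... | no  _ = ∀' z (sub y x A)
  sub y x (□ A)       = □ A

  -- Adm y x A : the substitution A(y/x) is admissible
  -- (no ∀□-free occurrence of x lies in the scope of a quantifier ∀y)
  data Adm (y x : Var) : Fm → Set where
    adm-atom : ∀ {p xs} → Adm y x (atom p xs)
    adm-eq   : ∀ {u v} → Adm y x (u ≐ v)
    adm-neg  : ∀ {A} → Adm y x A → Adm y x (¬' A)
    adm-imp  : ∀ {A B} → Adm y x A → Adm y x B → Adm y x (A ⇒ B)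
    adm-all≡ : ∀ {z A} → z ≡ x → Adm y x (∀' z A)
    adm-all  : ∀ {z A} → z ≢ x → (z ≡ y → ¬ FreeIn x A) → Adm y x A → Adm y x (∀' z A)
    adm-box  : ∀ {A} → Adm y x (□ A)

  -- Repl x y A B : B arises from A by replacing some (possibly none) ∀□-free
  -- occurrences of x by y, none of the new occurrences of y being captured.
  ReplVar : Var → Var → Var → Var → Set
  ReplVar x y u v = u ≡ v ⊎ (u ≡ x × v ≡ y)

  data Repl (x y : Var) : Fm → Fm → Set where
    rp-atom : ∀ {p xs ys} → Pointwise (ReplVar x y) xs ys → Repl x y (atom p xs) (atom p ys)
    rp-eq   : ∀ {u v u' v'} → ReplVar x y u u' → ReplVar x y v v' → Repl x y (u ≐ v) (u' ≐ v')
    rp-neg  : ∀ {A B} → Repl x y A B → Repl x y (¬' A) (¬' B)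
    rp-imp  : ∀ {A B A' B'} → Repl x y A A' → Repl x y B B' → Repl x y (A ⇒ B) (A' ⇒ B')
    rp-all= : ∀ {z A} → Repl x y (∀' z A) (∀' z A)
    rp-all  : ∀ {z A B} → z ≢ x → z ≢ y → Repl x y A B → Repl x y (∀' z A) (∀' z B)
    rp-box  : ∀ {A} → Repl x y (□ A) (□ A)

  -- Propositional tautologies: formulas true under every Boolean valuation of
  -- their propositionally-prime subformulas (atoms, identities, ∀-, □-formulas).
  ⟦_⟧ : Fm → (Fm → Bool) → Bool
  ⟦ ¬' A ⟧  v = not (⟦ A ⟧ v)
  ⟦ A ⇒ B ⟧ v = not (⟦ A ⟧ v) ∨ ⟦ B ⟧ v
  ⟦ atom p xs ⟧ v = v (atom p xs)
  ⟦ u ≐ w ⟧ v = v (u ≐ w)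
  ⟦ ∀' x A ⟧ v = v (∀' x A)
  ⟦ □ A ⟧ v = v (□ A)

  Taut : Fm → Set
  Taut A = (v : Fm → Bool) → ⟦ A ⟧ v ≡ true

  data FOL : Fm → Set where
    fol-taut : ∀ {A} → BoxFree A → Taut A → FOL A
    fol-inst : ∀ {x y A} → BoxFree A → Adm y x A → FOL (∀' x A ⇒ sub y x A)
    fol-dist : ∀ {x A B} → BoxFree A → BoxFree B → ¬ FreeIn x A →
               FOL (∀' x (A ⇒ B) ⇒ (A ⇒ ∀' x B))
    fol-refl : ∀ {x} → FOL (x ≐ x)
    fol-id   : ∀ {x y A B} → BoxFree A → Repl x y A B → FOL ((x ≐ y ∧' A) ⇒ B)
    fol-mp   : ∀ {A B} → FOL (A ⇒ B) → FOL A → FOL B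
    fol-gen  : ∀ {x A} → FOL A → FOL (∀' x A)

  data FOL□ : Fm → Set where
    ax-taut : ∀ {A} → Taut A → FOL□ A
    ax-K    : ∀ {A B} → FOL□ (□ (A ⇒ B) ⇒ (□ A ⇒ □ B))
    ax-T    : ∀ {A} → FOL□ (□ A ⇒ A)
    ax-5    : ∀ {A} → FOL□ (¬' □ A ⇒ □ (¬' □ A))
    ax-inst : ∀ {x y A} → Adm y x A → FOL□ (∀' x A ⇒ sub y x A)
    ax-dist : ∀ {x A B} → ¬ FreeIn x A → FOL□ (∀' x (A ⇒ B) ⇒ (A ⇒ ∀' x B))
    ax-refl : ∀ {x} → FOL□ (x ≐ x)
    ax-id   : ∀ {x y A B} → BoxFree A → Repl x y A B → FOL□ ((x ≐ y ∧' A) ⇒ B)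
    ax-□∀   : ∀ {x A} → FOL□ (□ A ⇒ ∀' x A)
    ax-non  : ∀ {A} → BoxFree A → ¬ FOL A → FOL□ (¬' □ A)
    r-nec   : ∀ {A} → FOL□ A → FOL□ (□ A)
    r-mp    : ∀ {A B} → FOL□ (A ⇒ B) → FOL□ A → FOL□ B

  FmSet : Set₁
  FmSet = Fm → Set

  _⊆_ : FmSet → FmSet → Set
  Γ ⊆ Δ = ∀ A → Γ A → Δ A

  conj : Fm → List Fm → Fm
  conj B []       = B
  conj B (C ∷ Cs) = B ∧' conj C Cs

  Consistent : FmSet → Set
  Consistent Γ = ¬ (Σ Fm λ B → Σ (List Fm) λ Bs →
                   Γ B × All Γ Bs × FOL□ (¬' conj B Bs))

  MaxConsistent : FmSet → Set₁
  MaxConsistent Γ = Consistent Γ × ((Δ : FmSet) → Γ ⊆ Δ → Consistent Δ → Δ ⊆ Γ)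

  ∃-Saturated : FmSet → Set
  ∃-Saturated Γ = ∀ x A → Γ (¬' ∀' x A) → ∃[ y ] (Adm y x A × Γ (¬' sub y x A))

  MC : FmSet → Set₁
  MC Γ = ∃-Saturated Γ × MaxConsistent Γ

  disj : Fm → List Fm → Fm
  disj F []       = F
  disj F (G ∷ Gs) = F ∨' disj G Gs

  elemDisj : Fm → Fm → List Fm → Fm
  elemDisj A B Cs = disj A (◇ B ∷ lmap □_ Cs)

-- Each formula X in question is settled: it is either a theorem of FOL□ or the
-- negation of one.  For □A this is the axiom ¬□A for □-free non-theorems A,
-- for ◇A it follows by necessitating a refutation of A, and it is inherited by
-- disjunctions.  For □(A ∨ R) with R settled, R can only fail to be provable by
-- being refutable, and then □(A ∨ R) stands or falls with □A.  A maximal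
-- consistent set contains every theorem and no refuted formula, so all such
-- sets agree on settled formulas.
module Submission where

open import Defs
open import Data.Bool using (Bool; true; false)
open import Data.List using (List; []; _∷_)
open import Data.List.Relation.Unary.Any using (here; there)
open import Data.List.Relation.Unary.All as All using (All; []; _∷_)
open import Data.List.Relation.Unary.All.Properties using (anti-mono; map⁺)
open import Data.List.Relation.Binary.Subset.Propositional using () renaming (_⊆_ to _⊆ᴸ_)
open import Data.List.Relation.Binary.Subset.Propositional.Properties using (∈-∷⁺ʳ; ∷⁺ʳ; xs⊆x∷xs; ⊆-trans)
open import Data.Product using (_×_; _,_; Σ)
open import Data.Sum using (_⊎_; inj₁; inj₂)
open import Function.Bundles using (_⇔_; mk⇔)
open import Relation.Nullary using (¬_)
open import Relation.Binary.PropositionalEquality using (_≡_; refl)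

module _ (S : Signature) where
  open Logic S

  FOL⊆FOL□ : ∀ {A} → FOL A → FOL□ A
  FOL⊆FOL□ (fol-taut _ t)     = ax-taut t
  FOL⊆FOL□ (fol-inst _ adm)   = ax-inst adm
  FOL⊆FOL□ (fol-dist _ _ ¬fr) = ax-dist ¬fr
  FOL⊆FOL□ fol-refl           = ax-refl
  FOL⊆FOL□ (fol-id bf rp)     = ax-id bf rp
  FOL⊆FOL□ (fol-mp p q)       = r-mp (FOL⊆FOL□ p) (FOL⊆FOL□ q)
  FOL⊆FOL□ (fol-gen p)        = r-mp ax-□∀ (r-nec (FOL⊆FOL□ p))

  □-mono : ∀ {F G} → FOL□ (F ⇒ G) → FOL□ (□ F ⇒ □ G)
  □-mono p = r-mp ax-K (r-nec p)

  taut-mp : ∀ {P Q} → Taut (P ⇒ Q) → FOL□ P → FOL□ Q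
  taut-mp t = r-mp (ax-taut t)

  taut-mp₂ : ∀ {P Q R} → Taut (P ⇒ Q ⇒ R) → FOL□ P → FOL□ Q → FOL□ R
  taut-mp₂ t p = r-mp (taut-mp t p)

  ∨-introˡ : ∀ {F G} → FOL□ F → FOL□ (F ∨' G)
  ∨-introˡ {F} {G} = taut-mp taut
    where
    taut : Taut (F ⇒ F ∨' G)
    taut v with ⟦ F ⟧ v
    ... | true  = refl
    ... | false = refl

  ∨-introʳ : ∀ {F G} → FOL□ G → FOL□ (F ∨' G)
  ∨-introʳ {F} {G} = taut-mp taut
    where
    taut : Taut (G ⇒ F ∨' G)
    taut v with ⟦ F ⟧ v | ⟦ G ⟧ v
    ... | true  | true  = refl
    ... | true  | false = refl
    ... | false | true  = refl
    ... | false | false = refl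

  ¬∨-intro : ∀ {F G} → FOL□ (¬' F) → FOL□ (¬' G) → FOL□ (¬' (F ∨' G))
  ¬∨-intro {F} {G} = taut-mp₂ taut
    where
    taut : Taut (¬' F ⇒ ¬' G ⇒ ¬' (F ∨' G))
    taut v with ⟦ F ⟧ v | ⟦ G ⟧ v
    ... | true  | true  = refl
    ... | true  | false = refl
    ... | false | true  = refl
    ... | false | false = refl

  ¬¬-intro : ∀ {F} → FOL□ F → FOL□ (¬' ¬' F)
  ¬¬-intro {F} = taut-mp taut
    where
    taut : Taut (F ⇒ ¬' ¬' F)
    taut v with ⟦ F ⟧ v
    ... | true  = refl
    ... | false = refl

  disjunctive-syllogism : ∀ {F G} → FOL□ (¬' G) → FOL□ (F ∨' G ⇒ F)
  disjunctive-syllogism {F} {G} = taut-mp taut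
    where
    taut : Taut (¬' G ⇒ F ∨' G ⇒ F)
    taut v with ⟦ F ⟧ v | ⟦ G ⟧ v
    ... | true  | true  = refl
    ... | true  | false = refl
    ... | false | true  = refl
    ... | false | false = refl

  modus-tollens : ∀ {F G} → FOL□ (F ⇒ G) → FOL□ (¬' G) → FOL□ (¬' F)
  modus-tollens {F} {G} = taut-mp₂ taut
    where
    taut : Taut ((F ⇒ G) ⇒ ¬' G ⇒ ¬' F)
    taut v with ⟦ F ⟧ v | ⟦ G ⟧ v
    ... | true  | true  = refl
    ... | true  | false = refl
    ... | false | true  = refl
    ... | false | false = refl

  ¬∧-elimʳ : ∀ {F G} → FOL□ F → FOL□ (¬' (F ∧' G)) → FOL□ (¬' G)
  ¬∧-elimʳ {F} {G} = taut-mp₂ taut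
    where
    taut : Taut (F ⇒ ¬' (F ∧' G) ⇒ ¬' G)
    taut v with ⟦ F ⟧ v | ⟦ G ⟧ v
    ... | true  | true  = refl
    ... | true  | false = refl
    ... | false | true  = refl
    ... | false | false = refl

  _⊨_ : (Fm → Bool) → Fm → Set
  v ⊨ F = ⟦ F ⟧ v ≡ true

  ⊨-∧'⁻ : ∀ {v} F G → v ⊨ (F ∧' G) → v ⊨ F × v ⊨ G
  ⊨-∧'⁻ {v} F G h with ⟦ F ⟧ v | ⟦ G ⟧ v
  ⊨-∧'⁻ F G h  | true  | true  = refl , refl
  ⊨-∧'⁻ F G () | true  | false
  ⊨-∧'⁻ F G () | false | _

  ⊨-∧'⁺ : ∀ {v} F G → v ⊨ F → v ⊨ G → v ⊨ (F ∧' G)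
  ⊨-∧'⁺ F G ⊨F ⊨G rewrite ⊨F | ⊨G = refl

  ⊨-conj⁻ : ∀ {v} B Bs → v ⊨ conj B Bs → All (v ⊨_) (B ∷ Bs)
  ⊨-conj⁻ B []       ⊨B = ⊨B ∷ []
  ⊨-conj⁻ B (C ∷ Cs) h  = let ⊨B , ⊨Cs = ⊨-∧'⁻ B (conj C Cs) h in ⊨B ∷ ⊨-conj⁻ C Cs ⊨Cs

  ⊨-conj⁺ : ∀ {v} B Bs → All (v ⊨_) (B ∷ Bs) → v ⊨ conj B Bs
  ⊨-conj⁺ B []       (⊨B ∷ []) = ⊨B
  ⊨-conj⁺ B (C ∷ Cs) (⊨B ∷ ⊨Cs) = ⊨-∧'⁺ B (conj C Cs) ⊨B (⊨-conj⁺ C Cs ⊨Cs)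

  conj-weaken : ∀ {B Bs B' Bs'} → B ∷ Bs ⊆ᴸ B' ∷ Bs' → FOL□ (conj B' Bs' ⇒ conj B Bs)
  conj-weaken {B} {Bs} {B'} {Bs'} sub = ax-taut taut
    where
    taut : Taut (conj B' Bs' ⇒ conj B Bs)
    taut v with ⟦ conj B' Bs' ⟧ v in ⊨conj'
    ... | false = refl
    ... | true  = ⊨-conj⁺ B Bs (anti-mono sub (⊨-conj⁻ B' Bs' ⊨conj'))

  _∪｛_｝ : FmSet → Fm → FmSet
  (Δ ∪｛ X ｝) C = Δ C ⊎ C ≡ X

  ∪｛｝-split : ∀ {Δ X} Cs → All (Δ ∪｛ X ｝) Cs → Σ (List Fm) λ Ls → All Δ Ls × Cs ⊆ᴸ X ∷ Ls
  ∪｛｝-split []       []               = [] , [] , λ ()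
  ∪｛｝-split (C ∷ Cs) (inj₂ refl ∷ ps) =
    let Ls , Δ-Ls , Cs⊆ = ∪｛｝-split Cs ps in
    Ls , Δ-Ls , ∈-∷⁺ʳ (here refl) Cs⊆
  ∪｛｝-split (C ∷ Cs) (inj₁ Δ-C ∷ ps) =
    let Ls , Δ-Ls , Cs⊆ = ∪｛｝-split Cs ps in
    C ∷ Ls , Δ-C ∷ Δ-Ls , ∈-∷⁺ʳ (there (here refl)) (⊆-trans Cs⊆ (∷⁺ʳ _ (xs⊆x∷xs Ls C)))

  consistent-∪｛｝ : ∀ {Δ X} → Consistent Δ → ¬ FOL□ (¬' X) → FOL□ X →
                    Consistent (Δ ∪｛ X ｝)
  consistent-∪｛｝ {Δ} {X} cΔ ¬⊢¬X ⊢X (B , Bs , B∈ , Bs∈ , ⊢¬conj)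
    with ∪｛｝-split (B ∷ Bs) (B∈ ∷ Bs∈)
  ... | Ls , Δ-Ls , ⊆X∷Ls = refute Ls Δ-Ls (modus-tollens (conj-weaken ⊆X∷Ls) ⊢¬conj)
    where
    refute : ∀ Ls → All Δ Ls → ¬ FOL□ (¬' conj X Ls)
    refute []       []            = ¬⊢¬X
    refute (L ∷ Ls) (Δ-L ∷ Δ-Ls) ⊢¬ = cΔ (L , Ls , Δ-L , Δ-Ls , ¬∧-elimʳ ⊢X ⊢¬)

  maximal-∋-theorem : ∀ {Δ X} → MaxConsistent Δ → ¬ FOL□ (¬' X) → ¬ ¬ FOL□ X → Δ X
  maximal-∋-theorem {Δ} {X} (cΔ , maximal) ¬⊢¬X ¬¬⊢X =
    maximal (Δ ∪｛ X ｝) (λ _ → inj₁) consistent X (inj₂ refl)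
    where
    consistent : Consistent (Δ ∪｛ X ｝)
    consistent inc = ¬¬⊢X λ ⊢X → consistent-∪｛｝ cΔ ¬⊢¬X ⊢X inc

  -- Double-negated form of "FOL□ X ⊎ FOL□ (¬' X)".
  Settled : Fm → Set
  Settled X = ¬ FOL□ X → ¬ ¬ FOL□ (¬' X)

  settled-transfer : ∀ {Γ Δ X} → Settled X → Consistent Γ → MaxConsistent Δ → Γ X → Δ X
  settled-transfer {X = X} settled cΓ mΔ Γ-X =
    maximal-∋-theorem mΔ ¬⊢¬X (λ ¬⊢X → settled ¬⊢X ¬⊢¬X)
    where
    ¬⊢¬X : ¬ FOL□ (¬' X)
    ¬⊢¬X ⊢¬X = cΓ (X , [] , Γ-X , [] , ⊢¬X)

  settled-⇔ : ∀ {Γ Δ X} → MaxConsistent Γ → MaxConsistent Δ → Settled X → Γ X ⇔ Δ X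
  settled-⇔ (cΓ , mΓ) (cΔ , mΔ) settled =
    mk⇔ (settled-transfer settled cΓ (cΔ , mΔ)) (settled-transfer settled cΔ (cΓ , mΓ))

  settled-∨ : ∀ {F G} → Settled F → Settled G → Settled (F ∨' G)
  settled-∨ sF sG ¬⊢F∨G ¬⊢¬[F∨G] =
    sF (λ ⊢F → ¬⊢F∨G (∨-introˡ ⊢F)) λ ⊢¬F →
    sG (λ ⊢G → ¬⊢F∨G (∨-introʳ ⊢G)) λ ⊢¬G →
    ¬⊢¬[F∨G] (¬∨-intro ⊢¬F ⊢¬G)

  settled-disj : ∀ {F Gs} → Settled F → All Settled Gs → Settled (disj F Gs)
  settled-disj sF []         = sF
  settled-disj sF (sG ∷ sGs) = settled-∨ sF (settled-disj sG sGs)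

  settled-□ : ∀ {A} → BoxFree A → Settled (□ A)
  settled-□ bA ¬⊢□A ¬⊢¬□A = ¬⊢¬□A (ax-non bA λ ⊢A → ¬⊢□A (r-nec (FOL⊆FOL□ ⊢A)))

  settled-◇ : ∀ {B} → BoxFree B → Settled (◇ B)
  settled-◇ bB ¬⊢◇B ¬⊢¬◇B =
    ¬⊢◇B (ax-non (bf-neg bB) λ ⊢¬B → ¬⊢¬◇B (¬¬-intro (r-nec (FOL⊆FOL□ ⊢¬B))))

  settled-□∨ : ∀ {A R} → BoxFree A → Settled R → Settled (□ (A ∨' R))
  settled-□∨ {A} bA sR ¬⊢□[A∨R] ¬⊢¬□[A∨R] =
    sR (λ ⊢R → ¬⊢□[A∨R] (r-nec (∨-introʳ ⊢R))) λ ⊢¬R →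
    ¬⊢¬□[A∨R] (modus-tollens (□-mono (disjunctive-syllogism ⊢¬R)) ⊢¬□A)
    where
    ⊢¬□A : FOL□ (¬' □ A)
    ⊢¬□A = ax-non bA λ ⊢A → ¬⊢□[A∨R] (r-nec (∨-introˡ (FOL⊆FOL□ ⊢A)))

  settled-□-elemDisj : ∀ {A B Cs} → BoxFree A → BoxFree B → All BoxFree Cs →
                       Settled (□ elemDisj A B Cs)
  settled-□-elemDisj bA bB bCs =
    settled-□∨ bA (settled-disj (settled-◇ bB) (map⁺ (All.map settled-□ bCs)))

lemma3 : (S : Signature) → let open Logic S in
    (Γ Δ : FmSet) → MC Γ → MC Δ →
    ((A : Fm) → BoxFree A →
       (Γ (□ A) ⇔ Δ (□ A)) × (Γ (◇ A) ⇔ Δ (◇ A)))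
    × ((A B : Fm) (Cs : List Fm) → BoxFree A → BoxFree B → All BoxFree Cs →
       Γ (□ elemDisj A B Cs) ⇔ Δ (□ elemDisj A B Cs))
lemma3 S Γ Δ (_ , mΓ) (_ , mΔ) =
    (λ A bA → agree (settled-□ S bA) , agree (settled-◇ S bA))
  , λ A B Cs bA bB bCs → agree (settled-□-elemDisj S bA bB bCs)
  where
  agree : ∀ {X} → Settled S X → Γ X ⇔ Δ X
  agree = settled-⇔ S mΓ mΔ
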